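{- Let $t$ be a positive integer and let $G$ be a $\{P_3+P_1,K_{t,t}\}$-free graph. Then $\mathsf{tree}\text{ - }\alpha(G)\le t$.
   Context: All graphs are finite, simple and undirected. $P_3+P_1$ is the disjoint union of the 3-vertex path and a single vertex. A graph is $\mathcal{F}$-free if it has no induced subgraph isomorphic to a member of $\mathcal{F}$. A tree decomposition of $G$ is a pair $(T,\{X_t\}_{t\in V(T)})$ with $T$ a tree and bags $X_t\subseteq V(G)$ such that every vertex lies in some bag, every edge has both endpoints in some bag, and for each vertex $v$ the nodes whose bags contain $v$ induce a connected subtree. $\mathsf{tree}\text{ - }\alpha(G)$ is the minimum over tree decompositions of $\max_t\alpha(G[X_t])$. -}

module Defs where

open import Data.Nat using (ℕ; zero; suc; _+_; _≤_; _<_)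
open import Data.Fin using (Fin; zero; suc; toℕ; inject₁; fromℕ)
open import Data.Fin.Subset using (Subset; _∈_; _⊆_; ∣_∣)
open import Data.Bool using (Bool; true; false; _xor_)
open import Data.Nat using (_<ᵇ_)
open import Data.Product using (Σ; _×_; ∃)
open import Data.Empty using (⊥)
open import Data.Unit using (⊤)
open import Relation.Nullary using (¬_)
open import Relation.Binary.PropositionalEquality using (_≡_)
open import Function.Definitions using (Injective)

record Graph (n : ℕ) : Set where
  field
    adj    : Fin n → Fin n → Bool
    sym    : ∀ u v → adj u v ≡ adj v u
    irrefl : ∀ v → adj v v ≡ false
open Graph public

InducedCopy : ∀ {k n} → Graph k → Graph n → Set
InducedCopy {k} {n} H G =
  Σ (Fin k → Fin n) λ f → Injective _≡_ _≡_ f × (∀ i j → adj H i j ≡ adj G (f i) (f j))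

Free : ∀ {k n} → Graph k → Graph n → Set
Free H G = ¬ InducedCopy H G

p3p1adj : Fin 4 → Fin 4 → Bool
p3p1adj zero (suc zero) = true
p3p1adj (suc zero) zero = true
p3p1adj (suc zero) (suc (suc zero)) = true
p3p1adj (suc (suc zero)) (suc zero) = true
p3p1adj _ _ = false

P3+P1 : Graph 4
P3+P1 = record { adj = p3p1adj ; sym = s ; irrefl = r }
  where
  s : ∀ u v → p3p1adj u v ≡ p3p1adj v u
  s zero zero = _≡_.refl
  s zero (suc zero) = _≡_.refl
  s zero (suc (suc zero)) = _≡_.refl
  s zero (suc (suc (suc zero))) = _≡_.refl
  s (suc zero) zero = _≡_.refl
  s (suc zero) (suc zero) = _≡_.refl
  s (suc zero) (suc (suc zero)) = _≡_.refl
  s (suc zero) (suc (suc (suc zero))) = _≡_.refl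
  s (suc (suc zero)) zero = _≡_.refl
  s (suc (suc zero)) (suc zero) = _≡_.refl
  s (suc (suc zero)) (suc (suc zero)) = _≡_.refl
  s (suc (suc zero)) (suc (suc (suc zero))) = _≡_.refl
  s (suc (suc (suc zero))) zero = _≡_.refl
  s (suc (suc (suc zero))) (suc zero) = _≡_.refl
  s (suc (suc (suc zero))) (suc (suc zero)) = _≡_.refl
  s (suc (suc (suc zero))) (suc (suc (suc zero))) = _≡_.refl
  r : ∀ v → p3p1adj v v ≡ false
  r zero = _≡_.refl
  r (suc zero) = _≡_.refl
  r (suc (suc zero)) = _≡_.refl
  r (suc (suc (suc zero))) = _≡_.refl

-- Complete bipartite graph K_{t,t} on Fin (t + t): sides {i < t} and {i ≥ t}
kttAdj : (t : ℕ) → Fin (t + t) → Fin (t + t) → Bool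
kttAdj t i j = (toℕ i <ᵇ t) xor (toℕ j <ᵇ t)

K : (t : ℕ) → Graph (t + t)
K t = record { adj = kttAdj t ; sym = s ; irrefl = r }
  where
  xor-comm : ∀ a b → a xor b ≡ b xor a
  xor-comm false false = _≡_.refl
  xor-comm false true = _≡_.refl
  xor-comm true false = _≡_.refl
  xor-comm true true = _≡_.refl
  xor-self : ∀ a → a xor a ≡ false
  xor-self false = _≡_.refl
  xor-self true = _≡_.refl
  s : ∀ u v → kttAdj t u v ≡ kttAdj t v u
  s u v = xor-comm (toℕ u <ᵇ t) (toℕ v <ᵇ t)
  r : ∀ v → kttAdj t v v ≡ false
  r v = xor-self (toℕ v <ᵇ t)

data WalkIn {m : ℕ} (T : Graph m) (P : Fin m → Set) : Fin m → Fin m → Set where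
  here : ∀ {a} → P a → WalkIn T P a a
  step : ∀ {a b c} → P a → adj T a b ≡ true → WalkIn T P b c → WalkIn T P a c

Connected : ∀ {m} → Graph m → Set
Connected {m} T = ∀ a b → WalkIn T (λ _ → ⊤) a b

-- A cycle of length k + 3 : distinct vertices c 0, …, c (k+2), consecutive ones
-- adjacent and the last adjacent to the first.
Cycle : ∀ {m} → Graph m → ℕ → Set
Cycle {m} T k =
  Σ (Fin (suc (suc (suc k))) → Fin m) λ c →
    Injective _≡_ _≡_ c ×
    (∀ (i : Fin (suc (suc k))) → adj T (c (inject₁ i)) (c (suc i)) ≡ true) ×
    (adj T (c (fromℕ (suc (suc k)))) (c zero) ≡ true)

Acyclic : ∀ {m} → Graph m → Set
Acyclic T = ∀ k → ¬ Cycle T k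

IsTree : ∀ {m} → Graph m → Set
IsTree {m} T = (1 ≤ m) × Connected T × Acyclic T

record TreeDecomposition {n : ℕ} (G : Graph n) : Set where
  field
    m       : ℕ
    T       : Graph m
    isTree  : IsTree T
    bag     : Fin m → Subset n
    cover   : ∀ v → ∃ λ s → v ∈ bag s
    edges   : ∀ u v → adj G u v ≡ true → ∃ λ s → (u ∈ bag s) × (v ∈ bag s)
    subtree : ∀ v s s' → v ∈ bag s → v ∈ bag s' → WalkIn T (λ r → v ∈ bag r) s s'
open TreeDecomposition public

Independent : ∀ {n} → Graph n → Subset n → Set
Independent G S = ∀ u v → u ∈ S → v ∈ S → adj G u v ≡ false

αInducedAtMost : ∀ {n} → Graph n → Subset n → ℕ → Set
αInducedAtMost G X k = ∀ S → S ⊆ X → Independent G S → ∣ S ∣ ≤ k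

TreeαAtMost : ∀ {n} → Graph n → ℕ → Set
TreeαAtMost G k = Σ (TreeDecomposition G) λ D → ∀ s → αInducedAtMost G (bag D s) k

-- If α(G) ≤ t, one bag suffices, and for t = 1 the graph is edgeless, so singleton
-- bags suffice. Otherwise fix an independent set I with |I| > t ≥ 2 and let S be the
-- set of vertices having a non-neighbour in I. Freeness of P₃+P₁ (applied with a
-- vertex of I as the isolated vertex, or as an end of the path) forces S to be
-- complete to V ∖ S and G[S] to be a disjoint union of cliques, while t vertices of
-- I and t independent vertices of V ∖ S would induce K_{t,t}, so α(G − S) ≤ t.
-- Hence the star whose centre bag is V ∖ S and whose leaf bags are (V ∖ S) ∪ C, one
-- for each clique C of G[S], is a tree decomposition: an independent set inside a
-- bag either avoids S, or lies in S and so in a single clique.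
module Submission where

open import Defs hiding (sym)
open import Data.Nat using (ℕ; zero; suc; _≤_; _<_; _<ᵇ_; _+_; z≤n; s≤s)
open import Data.Nat.Properties
  using (≤-trans; ≤-reflexive; <⇒≤; _<?_; ≮⇒≥; m≤m+n; n≮n; <ᵇ⇒<; <⇒<ᵇ)
open import Data.Fin using (Fin; zero; suc; toℕ; inject₁; fromℕ; _↑ˡ_; _↑ʳ_; splitAt)
open import Data.Fin.Properties
  using (suc-injective; any?; all?; toℕ<n; toℕ-↑ˡ; toℕ-↑ʳ;
         splitAt-↑ˡ; splitAt-↑ʳ; splitAt⁻¹-↑ˡ; splitAt⁻¹-↑ʳ)
  renaming (_≟_ to _≟ᶠ_)
open import Data.Fin.Subset
  using (Subset; _∈_; _∉_; _⊆_; ∣_∣; ⊤; ⊥; ∁; _∪_; ⁅_⁆; inside; outside)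
open import Data.Fin.Subset.Properties
  using (_∈?_; anySubset?; ∈⊤; ⊆⊤; ∉⊥; ∣⊥∣≡0; ∣⁅x⁆∣≡1; x∈⁅y⁆⇔x≡y; p⊆q⇒∣p∣≤∣q∣;
         x∈∁p⇒x∉p; x∉p⇒x∈∁p; x∈p∪q⁺; x∈p∪q⁻; p⊆p∪q)
open import Data.Vec using (_∷_; here; there; tabulate)
open import Data.Vec.Properties using (lookup∘tabulate; []=⇒lookup; lookup⇒[]=)
open import Data.Bool using (Bool; true; false; _xor_; if_then_else_)
open import Data.Bool.Properties using (T-≡; ¬-not) renaming (_≟_ to _≟ᵇ_)
open import Data.Maybe using (Maybe; just; nothing)
import Data.Maybe as Maybe
open import Data.Maybe.Properties using (just-injective) renaming (≡-dec to ≡-dec-Maybe)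
open import Data.Sum using (_⊎_; inj₁; inj₂; [_,_]′)
open import Data.Product using (Σ; _×_; _,_; ∃; proj₁; proj₂)
open import Data.Unit using (tt)
open import Function using (_∘_; _⇔_; mk⇔; Equivalence)
open import Function.Definitions using (Injective)
open import Relation.Nullary using (¬_; Dec; yes; no; does; contradiction)
open import Relation.Nullary.Decidable using (_×-dec_; _⊎-dec_; _→-dec_; dec-true)
open import Relation.Unary using (Pred; Decidable)
open import Relation.Binary.PropositionalEquality
  using (_≡_; _≢_; refl; sym; trans; cong; cong₂; subst)

private
  variable
    n k : ℕ

k≤∣p∣⇒injection : (p : Subset n) → k ≤ ∣ p ∣ →
                  Σ (Fin k → Fin n) λ f → Injective _≡_ _≡_ f × (∀ i → f i ∈ p)
k≤∣p∣⇒injection {k = zero} p _ = (λ ()) , (λ { {()} }) , λ ()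
k≤∣p∣⇒injection {k = suc k} (outside ∷ p) k≤∣p∣
  with f , f-inj , f∈p ← k≤∣p∣⇒injection p k≤∣p∣ =
  suc ∘ f , f-inj ∘ suc-injective , there ∘ f∈p
k≤∣p∣⇒injection {k = suc k} (inside ∷ p) (s≤s k≤∣p∣)
  with f , f-inj , f∈p ← k≤∣p∣⇒injection p k≤∣p∣ = g , g-inj , g∈p
  where
  g : Fin (suc k) → Fin (suc _)
  g zero    = zero
  g (suc i) = suc (f i)
  g-inj : Injective _≡_ _≡_ g
  g-inj {zero}  {zero}  _  = refl
  g-inj {suc i} {suc j} eq = cong suc (f-inj (suc-injective eq))
  g∈p : ∀ i → g i ∈ inside ∷ p
  g∈p zero    = here
  g∈p (suc i) = there (f∈p i)

toSubset : ∀ {ℓ} {P : Pred (Fin n) ℓ} → Decidable P → Subset n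
toSubset P? = tabulate (does ∘ P?)

module _ {ℓ} {P : Pred (Fin n) ℓ} (P? : Decidable P) where

  ∈-toSubset⁺ : ∀ {x} → P x → x ∈ toSubset P?
  ∈-toSubset⁺ {x} Px = lookup⇒[]= x _ (trans (lookup∘tabulate _ x) (dec-true (P? x) Px))

  ∈-toSubset⁻ : ∀ {x} → x ∈ toSubset P? → P x
  ∈-toSubset⁻ {x} x∈ with P? x | trans (sym (lookup∘tabulate _ x)) ([]=⇒lookup x∈)
  ... | yes Px | _ = Px

least : ∀ {ℓ} {P : Pred (Fin n) ℓ} → Decidable P → Maybe (Fin n)
least {zero}  P? = nothing
least {suc n} P? =
  if does (P? zero) then just zero else Maybe.map suc (least (P? ∘ suc))

least-sound : ∀ {ℓ} {P : Pred (Fin n) ℓ} (P? : Decidable P) {w} → least P? ≡ just w → P w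
least-sound {suc n} P? eq with P? zero | least (P? ∘ suc) in e | eq
... | yes P0 | _       | refl = P0
... | no  _  | just w′ | refl = least-sound (P? ∘ suc) e

least-complete : ∀ {ℓ} {P : Pred (Fin n) ℓ} (P? : Decidable P) {x} → P x →
                 ∃ λ w → least P? ≡ just w
least-complete {suc n} P? {x} Px with P? zero | x
... | yes _  | _     = zero , refl
... | no ¬P0 | zero  = contradiction Px ¬P0
... | no _   | suc y with w , e ← least-complete (P? ∘ suc) Px =
  suc w , cong (Maybe.map suc) e

least-cong : ∀ {ℓ} {P Q : Pred (Fin n) ℓ} (P? : Decidable P) (Q? : Decidable Q) →
             (∀ x → P x ⇔ Q x) → least P? ≡ least Q?
least-cong {zero}  P? Q? P⇔Q = refl
least-cong {suc n} P? Q? P⇔Q with P? zero | Q? zero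
... | yes _  | yes _  = refl
... | no _   | no _   = cong (Maybe.map suc) (least-cong (P? ∘ suc) (Q? ∘ suc) (P⇔Q ∘ suc))
... | yes p  | no ¬q  = contradiction (Equivalence.to (P⇔Q zero) p) ¬q
... | no ¬p  | yes q  = contradiction (Equivalence.from (P⇔Q zero) q) ¬p

starAdj : Fin (suc n) → Fin (suc n) → Bool
starAdj zero    zero    = false
starAdj zero    (suc _) = true
starAdj (suc _) zero    = true
starAdj (suc _) (suc _) = false

Star : ∀ n → Graph (suc n)
Star n = record { adj = starAdj ; sym = starAdj-sym ; irrefl = starAdj-irrefl }
  where
  starAdj-sym : ∀ u v → starAdj {n} u v ≡ starAdj v u
  starAdj-sym zero    zero    = refl
  starAdj-sym zero    (suc _) = refl
  starAdj-sym (suc _) zero    = refl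
  starAdj-sym (suc _) (suc _) = refl
  starAdj-irrefl : ∀ v → starAdj {n} v v ≡ false
  starAdj-irrefl zero    = refl
  starAdj-irrefl (suc _) = refl

star-walk : {P : Fin (suc n) → Set} → (∀ r → P r) → ∀ a b → WalkIn (Star n) P a b
star-walk P zero    zero    = here (P zero)
star-walk P zero    (suc b) = step (P zero) refl (here (P (suc b)))
star-walk P (suc a) zero    = step (P (suc a)) refl (here (P zero))
star-walk P (suc a) (suc b) = step (P (suc a)) refl (step (P zero) refl (here (P (suc b))))

leaf-adj⇒centre : ∀ {a b : Fin (suc n)} → a ≢ zero → starAdj a b ≡ true → b ≡ zero
leaf-adj⇒centre {a = zero}  {b}     a≢0 _  = contradiction refl a≢0
leaf-adj⇒centre {a = suc _} {zero}  _   _  = refl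

adj-leaf⇒centre : ∀ {a b : Fin (suc n)} → b ≢ zero → starAdj a b ≡ true → a ≡ zero
adj-leaf⇒centre {a = a} {b} b≢0 ab = leaf-adj⇒centre b≢0 (trans (Graph.sym (Star _) b a) ab)

edge-leaving-c₂ : ∀ k (c : Fin (suc (suc (suc k))) → Fin (suc n)) →
                  (∀ i → starAdj (c (inject₁ i)) (c (suc i)) ≡ true) →
                  starAdj (c (fromℕ (suc (suc k)))) (c zero) ≡ true →
                  ∃ λ j → j ≢ suc zero × starAdj (c (suc (suc zero))) (c j) ≡ true
edge-leaving-c₂ zero    c path close = zero , (λ ()) , close
edge-leaving-c₂ (suc k) c path close = suc (suc (suc zero)) , (λ ()) , path (suc (suc zero))

-- Whichever of c₁ and c₂ is a leaf has both its cycle neighbours at the centre.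
star-acyclic : Acyclic (Star n)
star-acyclic k (c , c-inj , path , close) with c (suc zero) ≟ᶠ zero
... | no c₁≢0 =
  contradiction (c-inj (trans (adj-leaf⇒centre c₁≢0 (path zero))
                              (sym (leaf-adj⇒centre c₁≢0 (path (suc zero)))))) λ ()
... | yes c₁≡0 with j , j≢1 , c₂~cⱼ ← edge-leaving-c₂ k c path close =
  contradiction (c-inj (trans (leaf-adj⇒centre c₂≢0 c₂~cⱼ) (sym c₁≡0))) j≢1
  where
  c₂≢0 : c (suc (suc zero)) ≢ zero
  c₂≢0 c₂≡0 with () ← c-inj (trans c₂≡0 (sym c₁≡0))

star-isTree : IsTree (Star n)
star-isTree = s≤s z≤n , star-walk (λ _ → tt) , star-acyclic

data Half (t : ℕ) : Fin (t + t) → Set where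
  left  : (i : Fin t) → Half t (i ↑ˡ t)
  right : (j : Fin t) → Half t (t ↑ʳ j)

half : ∀ t a → Half t a
half t a with splitAt t a in e
... | inj₁ i = subst (Half t) (splitAt⁻¹-↑ˡ e) (left i)
... | inj₂ j = subst (Half t) (splitAt⁻¹-↑ʳ e) (right j)

left<ᵇ : ∀ t (i : Fin t) → (toℕ (i ↑ˡ t) <ᵇ t) ≡ true
left<ᵇ t i = Equivalence.to T-≡ (<⇒<ᵇ (subst (_< t) (sym (toℕ-↑ˡ i t)) (toℕ<n i)))

right<ᵇ : ∀ t (j : Fin t) → (toℕ (t ↑ʳ j) <ᵇ t) ≡ false
right<ᵇ t j = ¬-not λ lt → n≮n t (≤-trans (s≤s t≤) (<ᵇ⇒< _ t (Equivalence.from T-≡ lt)))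
  where
  t≤ : t ≤ toℕ (t ↑ʳ j)
  t≤ = subst (t ≤_) (sym (toℕ-↑ʳ t j)) (m≤m+n t (toℕ j))

module _ {n} (G : Graph n) where

  _~_ _≁_ : Fin n → Fin n → Set
  u ~ v = adj G u v ≡ true
  u ≁ v = adj G u v ≡ false

  ~-sym : ∀ {u v} → u ~ v → v ~ u
  ~-sym {u} {v} u~v = trans (Graph.sym G v u) u~v

  ≁-sym : ∀ {u v} → u ≁ v → v ≁ u
  ≁-sym {u} {v} u≁v = trans (Graph.sym G v u) u≁v

  ~⇒≢ : ∀ {u v} → u ~ v → u ≢ v
  ~⇒≢ {u} u~v refl with () ← trans (sym u~v) (irrefl G u)

  ~-≁-distinct : ∀ {x u v} → x ~ u → x ≁ v → u ≢ v
  ~-≁-distinct x~u x≁v refl with () ← trans (sym x~u) x≁v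

  ≁⇒¬~ : ∀ {u v} → u ≁ v → ¬ u ~ v
  ≁⇒¬~ u≁v u~v with () ← trans (sym u~v) u≁v

  independent⇒¬~ : ∀ {X u v} → Independent G X → u ∈ X → v ∈ X → ¬ u ~ v
  independent⇒¬~ {u = u} {v} X-ind u∈X v∈X = ≁⇒¬~ (X-ind u v u∈X v∈X)

  independent? : Decidable (Independent G)
  independent? X =
    all? λ u → all? λ v → (u ∈? X) →-dec ((v ∈? X) →-dec (adj G u v ≟ᵇ false))

  inducedP₃+P₁ : ∀ {a b c d} → a ~ b → b ~ c → a ≁ c → a ≁ d → b ≁ d → c ≁ d → a ≢ c →
                 InducedCopy P3+P1 G
  inducedP₃+P₁ {a} {b} {c} {d} ab bc ac ad bd cd a≢c = f , f-inj , f-adj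
    where
    f : Fin 4 → Fin n
    f zero                   = a
    f (suc zero)             = b
    f (suc (suc zero))       = c
    f (suc (suc (suc zero))) = d
    a≢b : a ≢ b
    a≢b = ~⇒≢ ab
    b≢c : b ≢ c
    b≢c = ~⇒≢ bc
    a≢d : a ≢ d
    a≢d = ~-≁-distinct (~-sym ab) bd
    b≢d : b ≢ d
    b≢d = ~-≁-distinct ab ad
    c≢d : c ≢ d
    c≢d = ~-≁-distinct bc bd
    f-inj : Injective _≡_ _≡_ f
    f-inj {zero}                 {zero}                 _ = refl
    f-inj {zero}                 {suc zero}             e = contradiction e a≢b
    f-inj {zero}                 {suc (suc zero)}       e = contradiction e a≢c
    f-inj {zero}                 {suc (suc (suc zero))} e = contradiction e a≢d
    f-inj {suc zero}             {zero}                 e = contradiction (sym e) a≢b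
    f-inj {suc zero}             {suc zero}             _ = refl
    f-inj {suc zero}             {suc (suc zero)}       e = contradiction e b≢c
    f-inj {suc zero}             {suc (suc (suc zero))} e = contradiction e b≢d
    f-inj {suc (suc zero)}       {zero}                 e = contradiction (sym e) a≢c
    f-inj {suc (suc zero)}       {suc zero}             e = contradiction (sym e) b≢c
    f-inj {suc (suc zero)}       {suc (suc zero)}       _ = refl
    f-inj {suc (suc zero)}       {suc (suc (suc zero))} e = contradiction e c≢d
    f-inj {suc (suc (suc zero))} {zero}                 e = contradiction (sym e) a≢d
    f-inj {suc (suc (suc zero))} {suc zero}             e = contradiction (sym e) b≢d
    f-inj {suc (suc (suc zero))} {suc (suc zero)}       e = contradiction (sym e) c≢d
    f-inj {suc (suc (suc zero))} {suc (suc (suc zero))} _ = refl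
    f-adj : ∀ i j → adj P3+P1 i j ≡ adj G (f i) (f j)
    f-adj zero                   zero                   = sym (irrefl G a)
    f-adj zero                   (suc zero)             = sym ab
    f-adj zero                   (suc (suc zero))       = sym ac
    f-adj zero                   (suc (suc (suc zero))) = sym ad
    f-adj (suc zero)             zero                   = sym (~-sym ab)
    f-adj (suc zero)             (suc zero)             = sym (irrefl G b)
    f-adj (suc zero)             (suc (suc zero))       = sym bc
    f-adj (suc zero)             (suc (suc (suc zero))) = sym bd
    f-adj (suc (suc zero))       zero                   = sym (≁-sym ac)
    f-adj (suc (suc zero))       (suc zero)             = sym (~-sym bc)
    f-adj (suc (suc zero))       (suc (suc zero))       = sym (irrefl G c)
    f-adj (suc (suc zero))       (suc (suc (suc zero))) = sym cd
    f-adj (suc (suc (suc zero))) zero                   = sym (≁-sym ad)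
    f-adj (suc (suc (suc zero))) (suc zero)             = sym (≁-sym bd)
    f-adj (suc (suc (suc zero))) (suc (suc zero))       = sym (≁-sym cd)
    f-adj (suc (suc (suc zero))) (suc (suc (suc zero))) = sym (irrefl G d)

  inducedK : ∀ t (f g : Fin t → Fin n) → Injective _≡_ _≡_ f → Injective _≡_ _≡_ g →
             (∀ i j → f i ≁ f j) → (∀ i j → g i ≁ g j) → (∀ i j → f i ~ g j) →
             InducedCopy (K t) G
  inducedK t f g f-inj g-inj f-ind g-ind f~g = h , h-inj , h-adj
    where
    h : Fin (t + t) → Fin n
    h a = [ f , g ]′ (splitAt t a)
    h-left : ∀ i → h (i ↑ˡ t) ≡ f i
    h-left i = cong [ f , g ]′ (splitAt-↑ˡ t i t)
    h-right : ∀ j → h (t ↑ʳ j) ≡ g j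
    h-right j = cong [ f , g ]′ (splitAt-↑ʳ t t j)
    h-inj : Injective _≡_ _≡_ h
    h-inj {a} {b} e with half t a | half t b
    ... | left i  | left j  =
      cong (_↑ˡ t) (f-inj (trans (sym (h-left i)) (trans e (h-left j))))
    ... | right i | right j =
      cong (t ↑ʳ_) (g-inj (trans (sym (h-right i)) (trans e (h-right j))))
    ... | left i  | right j =
      contradiction (trans (sym (h-left i)) (trans e (h-right j))) (~⇒≢ (f~g i j))
    ... | right i | left j  =
      contradiction (trans (sym (h-left j)) (trans (sym e) (h-right i))) (~⇒≢ (f~g j i))
    via : ∀ {a b x y β} → adj (K t) a b ≡ β → h a ≡ x → h b ≡ y → adj G x y ≡ β →
          adj (K t) a b ≡ adj G (h a) (h b)
    via Kab≡β ha≡x hb≡y Gxy≡β = trans Kab≡β (sym (trans (cong₂ (adj G) ha≡x hb≡y) Gxy≡β))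
    h-adj : ∀ a b → adj (K t) a b ≡ adj G (h a) (h b)
    h-adj a b with half t a | half t b
    ... | left i  | left j  =
      via (cong₂ _xor_ (left<ᵇ t i) (left<ᵇ t j)) (h-left i) (h-left j) (f-ind i j)
    ... | right i | right j =
      via (cong₂ _xor_ (right<ᵇ t i) (right<ᵇ t j)) (h-right i) (h-right j) (g-ind i j)
    ... | left i  | right j =
      via (cong₂ _xor_ (left<ᵇ t i) (right<ᵇ t j)) (h-left i) (h-right j) (f~g i j)
    ... | right i | left j  =
      via (cong₂ _xor_ (right<ᵇ t i) (left<ᵇ t j)) (h-right i) (h-left j) (~-sym (f~g j i))

  _≃_ : Fin n → Fin n → Set
  u ≃ v = u ≡ v ⊎ u ~ v

  ≃-sym : ∀ {u v} → u ≃ v → v ≃ u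
  ≃-sym (inj₁ refl) = inj₁ refl
  ≃-sym (inj₂ u~v)  = inj₂ (~-sym u~v)

  _≃?_ : ∀ u v → Dec (u ≃ v)
  u ≃? v = (u ≟ᶠ v) ⊎-dec (adj G u v ≟ᵇ true)

  independent⇒≃⇒≡ : ∀ {X u v} → Independent G X → u ∈ X → v ∈ X → u ≃ v → u ≡ v
  independent⇒≃⇒≡ X-ind u∈X v∈X (inj₁ u≡v) = u≡v
  independent⇒≃⇒≡ X-ind u∈X v∈X (inj₂ u~v) =
    contradiction u~v (independent⇒¬~ X-ind u∈X v∈X)

  -- Leaf w of the star gets the clique of G[S] whose least vertex is w (if there is
  -- one) on top of the centre bag V ∖ S.
  module StarDecomposition {t} (1≤t : 1 ≤ t) (S : Subset n)
    (S-transitive : ∀ {u v w} → u ∈ S → v ∈ S → w ∈ S → u ~ v → v ~ w → u ≢ w → u ~ w)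
    (S-complete : ∀ {s x} → s ∈ S → x ∉ S → s ~ x)
    (∁S-α≤t : αInducedAtMost G (∁ S) t) where

    ≃-trans : ∀ {u v w} → u ∈ S → v ∈ S → w ∈ S → u ≃ v → v ≃ w → u ≃ w
    ≃-trans _   _   _   (inj₁ refl) v≃w         = v≃w
    ≃-trans _   _   _   u≃v         (inj₁ refl) = u≃v
    ≃-trans {u} {v} {w} u∈S v∈S w∈S (inj₂ u~v) (inj₂ v~w) with u ≟ᶠ w
    ... | yes u≡w = inj₁ u≡w
    ... | no  u≢w = inj₂ (S-transitive u∈S v∈S w∈S u~v v~w u≢w)

    rep : Fin n → Maybe (Fin n)
    rep v = least λ w → (w ∈? S) ×-dec (w ≃? v)

    rep-sound : ∀ {v w} → rep v ≡ just w → w ∈ S × w ≃ v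
    rep-sound = least-sound _

    rep-complete : ∀ {v} → v ∈ S → ∃ λ w → rep v ≡ just w
    rep-complete v∈S = least-complete _ (v∈S , inj₁ refl)

    rep-cong : ∀ {u v} → u ∈ S → v ∈ S → u ≃ v → rep u ≡ rep v
    rep-cong u∈S v∈S u≃v = least-cong _ _ λ w → mk⇔
      (λ (w∈S , w≃u) → w∈S , ≃-trans w∈S u∈S v∈S w≃u u≃v)
      (λ (w∈S , w≃v) → w∈S , ≃-trans w∈S v∈S u∈S w≃v (≃-sym u≃v))

    rep≡just? : ∀ w v → Dec (rep v ≡ just w)
    rep≡just? w v = ≡-dec-Maybe _≟ᶠ_ (rep v) (just w)

    class : Fin n → Subset n
    class w = toSubset (rep≡just? w)

    starBag : Fin (suc n) → Subset n
    starBag zero    = ∁ S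
    starBag (suc w) = ∁ S ∪ class w

    ∁S⊆starBag : ∀ s → ∁ S ⊆ starBag s
    ∁S⊆starBag zero    = λ x∈ → x∈
    ∁S⊆starBag (suc w) = p⊆p∪q (class w)

    rep⇒∈starBag : ∀ {v w} → rep v ≡ just w → v ∈ starBag (suc w)
    rep⇒∈starBag rep≡w = x∈p∪q⁺ (inj₂ (∈-toSubset⁺ (rep≡just? _) rep≡w))

    ∈starBag∩S⇒rep : ∀ {v} s → v ∈ S → v ∈ starBag s →
                     ∃ λ w → s ≡ suc w × rep v ≡ just w
    ∈starBag∩S⇒rep zero    v∈S v∈∁S = contradiction v∈S (x∈∁p⇒x∉p v∈∁S)
    ∈starBag∩S⇒rep (suc w) v∈S v∈bag with x∈p∪q⁻ (∁ S) (class w) v∈bag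
    ... | inj₁ v∈∁S   = contradiction v∈S (x∈∁p⇒x∉p v∈∁S)
    ... | inj₂ v∈class = w , refl , ∈-toSubset⁻ (rep≡just? w) v∈class

    starBag∩S-≃ : ∀ {u v} s → u ∈ S → v ∈ S → u ∈ starBag s → v ∈ starBag s → u ≃ v
    starBag∩S-≃ s u∈S v∈S u∈bag v∈bag
      with w , refl , rep-u ← ∈starBag∩S⇒rep s u∈S u∈bag
         | _ , refl , rep-v ← ∈starBag∩S⇒rep s v∈S v∈bag
      with w∈S , w≃u ← rep-sound rep-u
         | _ , w≃v ← rep-sound rep-v
      = ≃-trans u∈S w∈S v∈S (≃-sym w≃u) w≃v

    starBag-covers : ∀ v → ∃ λ s → v ∈ starBag s
    starBag-covers v with v ∈? S
    ... | no  v∉S = zero , x∉p⇒x∈∁p v∉S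
    ... | yes v∈S with w , rep≡w ← rep-complete v∈S = suc w , rep⇒∈starBag rep≡w

    starBag-edges : ∀ u v → u ~ v → ∃ λ s → u ∈ starBag s × v ∈ starBag s
    starBag-edges u v u~v with u ∈? S | v ∈? S
    ... | no u∉S  | _ with s , v∈ ← starBag-covers v =
      s , ∁S⊆starBag s (x∉p⇒x∈∁p u∉S) , v∈
    ... | yes _   | no v∉S with s , u∈ ← starBag-covers u =
      s , u∈ , ∁S⊆starBag s (x∉p⇒x∈∁p v∉S)
    ... | yes u∈S | yes v∈S with w , rep≡w ← rep-complete u∈S =
      suc w , rep⇒∈starBag rep≡w ,
      rep⇒∈starBag (trans (sym (rep-cong u∈S v∈S (inj₂ u~v))) rep≡w)

    starBag-subtree : ∀ v s s′ → v ∈ starBag s → v ∈ starBag s′ →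
                      WalkIn (Star n) (λ r → v ∈ starBag r) s s′
    starBag-subtree v s s′ v∈s v∈s′ with v ∈? S
    ... | no v∉S = star-walk (λ r → ∁S⊆starBag r (x∉p⇒x∈∁p v∉S)) s s′
    ... | yes v∈S
      with w , refl , rep≡w ← ∈starBag∩S⇒rep s v∈S v∈s
         | _ , refl , rep≡w′ ← ∈starBag∩S⇒rep s′ v∈S v∈s′
      with refl ← just-injective (trans (sym rep≡w) rep≡w′)
      = here v∈s

    starBag-α≤t : ∀ s → αInducedAtMost G (starBag s) t
    starBag-α≤t s X X⊆bag X-ind with any? (λ x → (x ∈? X) ×-dec (x ∈? S))
    ... | no X∩S=∅ = ∁S-α≤t X (λ x∈X → x∉p⇒x∈∁p λ x∈S → X∩S=∅ (_ , x∈X , x∈S)) X-ind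
    ... | yes (x₀ , x₀∈X , x₀∈S) =
      ≤-trans (p⊆q⇒∣p∣≤∣q∣ X⊆⁅x₀⁆) (≤-trans (≤-reflexive (∣⁅x⁆∣≡1 x₀)) 1≤t)
      where
      X⊆S : ∀ {x} → x ∈ X → x ∈ S
      X⊆S {x} x∈X with x ∈? S
      ... | yes x∈S = x∈S
      ... | no  x∉S = contradiction (S-complete x₀∈S x∉S) (independent⇒¬~ X-ind x₀∈X x∈X)
      X⊆⁅x₀⁆ : X ⊆ ⁅ x₀ ⁆
      X⊆⁅x₀⁆ x∈X = Equivalence.from x∈⁅y⁆⇔x≡y (independent⇒≃⇒≡ X-ind x∈X x₀∈X
        (starBag∩S-≃ s (X⊆S x∈X) x₀∈S (X⊆bag x∈X) (X⊆bag x₀∈X)))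

    treeα≤t : TreeαAtMost G t
    treeα≤t = record
      { m = suc n ; T = Star n ; isTree = star-isTree ; bag = starBag
      ; cover = starBag-covers ; edges = starBag-edges ; subtree = starBag-subtree
      } , starBag-α≤t

  module LargeIndependentSet (P-free : Free P3+P1 G)
                             (I : Subset n) (I-ind : Independent G I) (3≤∣I∣ : 3 ≤ ∣ I ∣)
                             where

    MissesI : Fin n → Set
    MissesI u = ∃ λ i → i ∈ I × u ≁ i

    missesI? : ∀ u → Dec (MissesI u)
    missesI? u = any? λ i → (i ∈? I) ×-dec (adj G u i ≟ᵇ false)

    S : Subset n
    S = toSubset missesI?

    ∈S⁻ : ∀ {u} → u ∈ S → MissesI u
    ∈S⁻ = ∈-toSubset⁻ missesI?

    ∉S⇒complete : ∀ {u i} → u ∉ S → i ∈ I → u ~ i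
    ∉S⇒complete u∉S i∈I = ¬-not λ u≁i → u∉S (∈-toSubset⁺ missesI? (_ , i∈I , u≁i))

    I-≁ : ∀ {i j} → i ∈ I → j ∈ I → i ≁ j
    I-≁ {i} {j} = I-ind i j

    g : Fin 3 → Fin n
    g = proj₁ (k≤∣p∣⇒injection I 3≤∣I∣)

    g-inj : Injective _≡_ _≡_ g
    g-inj = proj₁ (proj₂ (k≤∣p∣⇒injection I 3≤∣I∣))

    g∈I : ∀ i → g i ∈ I
    g∈I = proj₂ (proj₂ (k≤∣p∣⇒injection I 3≤∣I∣))

    g-≢ : ∀ {i j x} → i ≢ j → g i ≡ x → g j ≢ x
    g-≢ i≢j gi≡x gj≡x = i≢j (g-inj (trans gi≡x (sym gj≡x)))

    I-avoiding : ∀ a b → ∃ λ z → z ∈ I × z ≢ a × z ≢ b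
    I-avoiding a b with g zero ≟ᶠ a | g zero ≟ᶠ b | g (suc zero) ≟ᶠ a | g (suc zero) ≟ᶠ b
    ... | no g₀≢a  | no g₀≢b  | _        | _        = g zero , g∈I zero , g₀≢a , g₀≢b
    ... | _        | _        | no g₁≢a  | no g₁≢b  = g (suc zero) , g∈I (suc zero) , g₁≢a , g₁≢b
    ... | yes g₀≡a | _        | yes g₁≡a | _        =
      contradiction (g-inj (trans g₀≡a (sym g₁≡a))) λ ()
    ... | _        | yes g₀≡b | _        | yes g₁≡b =
      contradiction (g-inj (trans g₀≡b (sym g₁≡b))) λ ()
    ... | yes g₀≡a | _        | _        | yes g₁≡b =
      g (suc (suc zero)) , g∈I (suc (suc zero)) , g-≢ (λ ()) g₀≡a , g-≢ (λ ()) g₁≡b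
    ... | _        | yes g₀≡b | yes g₁≡a | _        =
      g (suc (suc zero)) , g∈I (suc (suc zero)) , g-≢ (λ ()) g₁≡a , g-≢ (λ ()) g₀≡b

    S-unique-neighbour : ∀ {u j j′} → u ∈ S → j ∈ I → j′ ∈ I → u ~ j → u ~ j′ → j ≡ j′
    S-unique-neighbour {j = j} {j′} u∈S j∈I j′∈I u~j u~j′ with j ≟ᶠ j′
    ... | yes j≡j′ = j≡j′
    ... | no  j≢j′ with i , i∈I , u≁i ← ∈S⁻ u∈S = contradiction
      (inducedP₃+P₁ (~-sym u~j) u~j′ (I-≁ j∈I j′∈I) (I-≁ j∈I i∈I) u≁i (I-≁ j′∈I i∈I) j≢j′)
      P-free

    S-≁-other : ∀ {u j y} → u ∈ S → j ∈ I → y ∈ I → u ~ j → y ≢ j → u ≁ y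
    S-≁-other {u} {y = y} u∈S j∈I y∈I u~j y≢j with adj G u y in u~y
    ... | false = refl
    ... | true  = contradiction (S-unique-neighbour u∈S y∈I j∈I u~y u~j) y≢j

    S-non-neighbour : ∀ {u} → u ∈ S → ∀ a → ∃ λ z → z ∈ I × z ≢ a × u ≁ z
    S-non-neighbour {u} u∈S a with y , y∈I , y≢a , _ ← I-avoiding a a with adj G u y in u~y
    ... | false = y , y∈I , y≢a , u~y
    ... | true with z , z∈I , z≢a , z≢y ← I-avoiding a y =
      z , z∈I , z≢a , S-≁-other u∈S y∈I z∈I u~y z≢y

    S-complete : ∀ {s x} → s ∈ S → x ∉ S → s ~ x
    S-complete {s} {x} s∈S x∉S with adj G s x in s~x
    ... | true  = refl
    ... | false
      with i , i∈I , s≁i ← ∈S⁻ s∈S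
      with j , j∈I , j≢i , s≁j ← S-non-neighbour s∈S i
      = contradiction (inducedP₃+P₁ (~-sym (∉S⇒complete x∉S i∈I)) (∉S⇒complete x∉S j∈I)
          (I-≁ i∈I j∈I) (≁-sym s≁i) (≁-sym s~x) (≁-sym s≁j) (j≢i ∘ sym)) P-free

    I-neighbour-along-edge : ∀ {u v z} → u ∈ S → v ∈ S → u ~ v → z ∈ I → z ~ u → z ≃ v
    I-neighbour-along-edge {u} {v} {z} u∈S v∈S u~v z∈I z~u
      with z ≟ᶠ v | adj G z v in z~v
    ... | yes z≡v | _     = inj₁ z≡v
    ... | no  _   | true  = inj₂ refl
    ... | no  z≢v | false with y , y∈I , y≢z , v≁y ← S-non-neighbour v∈S z = contradiction
      (inducedP₃+P₁ z~u u~v z~v (I-≁ z∈I y∈I) (S-≁-other u∈S z∈I y∈I (~-sym z~u) y≢z) v≁y z≢v)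
      P-free

    I-neighbour-along-path : ∀ {u v w z} → u ∈ S → v ∈ S → w ∈ S → u ~ v → v ~ w →
                             z ∈ I → z ~ u → z ≃ w
    I-neighbour-along-path u∈S v∈S w∈S u~v v~w z∈I z~u
      with I-neighbour-along-edge u∈S v∈S u~v z∈I z~u
    ... | inj₁ refl = inj₂ v~w
    ... | inj₂ z~v  = I-neighbour-along-edge v∈S w∈S v~w z∈I z~v

    induced-P₃-end-misses-I : ∀ {u v w z} → u ∈ S → v ∈ S → w ∈ S → u ~ v → v ~ w →
                              u ≁ w → u ≢ w → z ∈ I → z ≁ u
    induced-P₃-end-misses-I {u} {z = z} u∈S v∈S w∈S u~v v~w u≁w u≢w z∈I
      with adj G z u in z~u
    ... | false = refl
    ... | true with I-neighbour-along-path u∈S v∈S w∈S u~v v~w z∈I z~u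
    ...   | inj₁ refl = contradiction (~-sym z~u) (≁⇒¬~ u≁w)
    ...   | inj₂ z~w with y , y∈I , y≢z , _ ← I-avoiding z z = contradiction
      (inducedP₃+P₁ (~-sym z~u) z~w u≁w (S-≁-other u∈S z∈I y∈I (~-sym z~u) y≢z)
         (I-≁ z∈I y∈I) (S-≁-other w∈S z∈I y∈I (~-sym z~w) y≢z) u≢w)
      P-free

    S-transitive : ∀ {u v w} → u ∈ S → v ∈ S → w ∈ S → u ~ v → v ~ w → u ≢ w → u ~ w
    S-transitive {u} {v} {w} u∈S v∈S w∈S u~v v~w u≢w with adj G u w in u~w
    ... | true  = refl
    ... | false with z , z∈I , v≁z ← ∈S⁻ v∈S = contradiction
      (inducedP₃+P₁ u~v v~w u~w
         (≁-sym (induced-P₃-end-misses-I u∈S v∈S w∈S u~v v~w u~w u≢w z∈I)) v≁z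
         (≁-sym (induced-P₃-end-misses-I w∈S v∈S u∈S (~-sym v~w) (~-sym u~v) (≁-sym u~w)
                   (u≢w ∘ sym) z∈I))
         u≢w) P-free

    ∁S-α≤t : ∀ {t} → Free (K t) G → t ≤ ∣ I ∣ → αInducedAtMost G (∁ S) t
    ∁S-α≤t {t} K-free t≤∣I∣ X X⊆∁S X-ind = ≮⇒≥ λ t<∣X∣ →
      let f , f-inj , f∈I = k≤∣p∣⇒injection I t≤∣I∣
          h , h-inj , h∈X = k≤∣p∣⇒injection X (<⇒≤ t<∣X∣)
      in K-free (inducedK t f h f-inj h-inj (λ i j → I-≁ (f∈I i) (f∈I j))
                  (λ i j → X-ind (h i) (h j) (h∈X i) (h∈X j))
                  (λ i j → ~-sym (∉S⇒complete (x∈∁p⇒x∉p (X⊆∁S (h∈X j))) (f∈I i))))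

    treeα≤t : ∀ {t} → Free (K t) G → 1 ≤ t → t ≤ ∣ I ∣ → TreeαAtMost G t
    treeα≤t K-free 1≤t t≤∣I∣ =
      StarDecomposition.treeα≤t 1≤t S S-transitive S-complete (∁S-α≤t K-free t≤∣I∣)

  K₁-free⇒edgeless : Free (K 1) G → ∀ u v → u ≁ v
  K₁-free⇒edgeless K-free u v with adj G u v in u~v
  ... | false = refl
  ... | true  = contradiction (inducedK 1 (λ _ → u) (λ _ → v) Fin1-inj Fin1-inj
                  (λ _ _ → irrefl G u) (λ _ _ → irrefl G v) (λ _ _ → u~v)) K-free
    where
    Fin1-inj : ∀ {x} → Injective _≡_ _≡_ (λ (_ : Fin 1) → x)
    Fin1-inj {x} {zero} {zero} _ = refl

  edgeless⇒treeα≤1 : (∀ u v → u ≁ v) → TreeαAtMost G 1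
  edgeless⇒treeα≤1 edgeless = StarDecomposition.treeα≤t (s≤s z≤n) ⊤
    (λ {u} {v} _ _ _ u~v _ _ → contradiction u~v (≁⇒¬~ (edgeless u v)))
    (λ _ x∉⊤ → contradiction ∈⊤ x∉⊤) ∁⊤-α≤1
    where
    ∁⊤-α≤1 : αInducedAtMost G (∁ ⊤) 1
    ∁⊤-α≤1 X X⊆∁⊤ _ = ≤-trans (p⊆q⇒∣p∣≤∣q∣ X⊆⊥) (≤-trans (≤-reflexive (∣⊥∣≡0 n)) z≤n)
      where
      X⊆⊥ : X ⊆ ⊥
      X⊆⊥ x∈X = contradiction ∈⊤ (x∈∁p⇒x∉p (X⊆∁⊤ x∈X))

  α≤t⇒treeα≤t : ∀ {t} → 1 ≤ t → αInducedAtMost G ⊤ t → TreeαAtMost G t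
  α≤t⇒treeα≤t 1≤t α≤t = StarDecomposition.treeα≤t 1≤t ⊥
    (λ u∈⊥ → contradiction u∈⊥ ∉⊥) (λ s∈⊥ → contradiction s∈⊥ ∉⊥) (λ X _ → α≤t X ⊆⊤)

  α≤⊎large-independent : ∀ t →
                         αInducedAtMost G ⊤ t ⊎ ∃ λ I → Independent G I × t < ∣ I ∣
  α≤⊎large-independent t with anySubset? (λ X → independent? X ×-dec (t <? ∣ X ∣))
  ... | yes large = inj₂ large
  ... | no ∄large = inj₁ λ X _ X-ind → ≮⇒≥ λ t<∣X∣ → ∄large (X , X-ind , t<∣X∣)

corollary5p4 : (t : ℕ) → 1 ≤ t → (n : ℕ) → (G : Graph n) →
               Free P3+P1 G → Free (K t) G → TreeαAtMost G t
corollary5p4 zero () n G P-free K-free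
corollary5p4 (suc zero) _ n G _ K-free = edgeless⇒treeα≤1 G (K₁-free⇒edgeless G K-free)
corollary5p4 t@(suc (suc _)) 1≤t n G P-free K-free with α≤⊎large-independent G t
... | inj₁ α≤t = α≤t⇒treeα≤t G 1≤t α≤t
... | inj₂ (I , I-ind , t<∣I∣) = LargeIndependentSet.treeα≤t G P-free I I-ind
  (≤-trans (s≤s (s≤s (s≤s z≤n))) t<∣I∣) K-free 1≤t (<⇒≤ t<∣I∣)
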